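{- Let $\mathcal{F}$ be a 2-construction scheme and for $\alpha\in\omega_1$ let $L_\alpha=\{2k+\Xi_\alpha(k): k\in\omega\setminus 1,\ \Xi_\alpha(k)\ge 0\}$ and $R_\alpha=\{2k+(1-\Xi_\alpha(k)): k\in\omega\setminus 1,\ \Xi_\alpha(k)\ge0\}$. Then the gap $(L_\alpha,R_\alpha)_{\alpha\in\omega_1}$ is levelwise-separable; that is, there is $C\subseteq\omega$ such that $(L_{\alpha+1}\setminus L_\alpha)\setminus C$ and $C\cap(R_{\alpha+1}\setminus R_\alpha)$ are finite for every $\alpha\in\omega_1$.
   Context: A type is a sequence $\tau=\langle m_k,n_{k+1},r_{k+1}\rangle_{k\in\omega}$ of natural numbers with $m_0=1$, $n_{k+1}\ge2$, $m_k>r_{k+1}$, $m_{k+1}=r_{k+1}+(m_k-r_{k+1})n_{k+1}$; it is good if for every $r\in\omega$ there are infinitely many $k$ with $r_k=r$ (all types are assumed good). A construction scheme of type $\tau$ is a family $\mathcal{F}$ of nonempty finite subsets of $\omega_1$, cofinal in the finite subsets of $\omega_1$ under $\subseteq$, each of cardinality $m_k$ for some $k$, such that, writing $\mathcal{F}_k=\{F\in\mathcal{F}:|F|=m_k\}$: (i) for $E,F\in\mathcal{F}_k$, $E\cap F$ is an initial segment of both; (ii) every $F\in\mathcal{F}_{k+1}$ is a union $F_0\cup\dots\cup F_{n_{k+1}-1}$ of members of $\mathcal{F}_k$ forming a $\Delta$-system with root $R(F)$, $|R(F)|=r_{k+1}$, $R(F)<F_0\setminus R(F)<\dots<F_{n_{k+1}-1}\setminus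 R(F)$. A 2-construction scheme is one whose type has $n_{k+1}=2$ for all $k$. For $\alpha\in\omega_1$: $\Xi_\alpha(0)=0$, and for $k\ge1$ take $F\in\mathcal{F}_k$ with $\alpha\in F$ and let $\Xi_\alpha(k)=-1$ if $\alpha\in R(F)$, $\Xi_\alpha(k)=i$ if $\alpha\in F_i\setminus R(F)$ (independent of the choice of $F$). (It is known that $(L_\alpha,R_\alpha)_{\alpha\in\omega_1}$ is a $\subseteq^*$-increasing gap.) An $(\omega_1,\omega_1)$-gap is levelwise-separable if the pregap $(L_{\alpha+1}\setminus L_\alpha,R_{\alpha+1}\setminus R_\alpha)_{\alpha\in\omega_1}$ is not a gap, i.e. can be separated. -}

module Defs where

open import Data.Nat using (ℕ; zero; suc; _+_; _*_; _∸_; _<_; _≤_)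
open import Data.Fin as Fin using (Fin)
open import Data.List using (List; []; _∷_; _++_; length)
open import Data.List.Membership.Propositional using (_∈_)
open import Data.List.Relation.Unary.All using (All)
open import Data.List.Relation.Unary.Linked using (Linked)
open import Data.Product using (Σ; ∃; ∃-syntax; _×_; _,_)
open import Data.Sum using (_⊎_)
open import Data.Empty using (⊥)
open import Relation.Nullary using (¬_)
open import Relation.Binary.PropositionalEquality using (_≡_)
open import Relation.Binary.Structures using (IsStrictTotalOrder)
open import Induction.WellFounded using (WellFounded)

-- ω₁, axiomatised up to isomorphism: a strict well-order that is
-- uncountable (no sequence exhausts it) and all of whose proper initial
-- segments are countable (enumerated by a sequence).

record Omega1 : Set₁ where
  field
    Carrier  : Set
    _<ω_     : Carrier → Carrier → Set
    isSTO    : IsStrictTotalOrder _≡_ _<ω_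
    wf       : WellFounded _<ω_
    uncountable : (f : ℕ → Carrier) → ∃[ α ] ((n : ℕ) → ¬ (f n ≡ α))
    countableSegments : (α : Carrier) →
      Σ (ℕ → Carrier) λ f → ((β : Carrier) → β <ω α → ∃[ n ] (f n ≡ β))

  _≤ω_ : Carrier → Carrier → Set
  α ≤ω β = α <ω β ⊎ α ≡ β

  IsSucc : Carrier → Carrier → Set
  IsSucc α β = α <ω β × ((γ : Carrier) → α <ω γ → β ≤ω γ)

-- Types with n_{k+1} = 2 for all k.  A type is determined by the
-- sequence r (r 0 unused), with m 0 = 1, m (k+1) = r(k+1) + (m k - r(k+1)) * 2.

m : (ℕ → ℕ) → ℕ → ℕ
m r zero    = 1
m r (suc k) = r (suc k) + (m r k ∸ r (suc k)) * 2

IsGood2Type : (ℕ → ℕ) → Set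
IsGood2Type r =
  ((k : ℕ) → r (suc k) < m r k) ×
  ((x k : ℕ) → ∃[ k' ] (k < k' × r k' ≡ x))

-- Construction schemes.  Finite subsets of ω₁ are represented by
-- strictly increasing lists; 𝓕 is a predicate on such lists.

module Scheme (W : Omega1) (r : ℕ → ℕ) (𝓕 : List (Omega1.Carrier W) → Set) where
  open Omega1 W

  InLevel : ℕ → List Carrier → Set
  InLevel k F = 𝓕 F × length F ≡ m r k

  -- F ∈ 𝓕_{k+1} decomposes as F = R ∪ F₀ ∪ F₁ with F₀ = R ++ A, F₁ = R ++ B,
  -- R < A < B (ordering is given by F being increasing), |R| = r_{k+1},
  -- and F₀, F₁ ∈ 𝓕_k.  (Root of the Δ-system is R.)
  Decomp : ℕ → List Carrier → List Carrier → List Carrier → List Carrier → Set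
  Decomp k F R A B =
    F ≡ R ++ (A ++ B) × length R ≡ r (suc k) ×
    InLevel k (R ++ A) × InLevel k (R ++ B)

  record IsConstructionScheme : Set where
    field
      increasing : (F : List Carrier) → 𝓕 F → Linked _<ω_ F
      nonempty   : (F : List Carrier) → 𝓕 F → ¬ (F ≡ [])
      sizes      : (F : List Carrier) → 𝓕 F → ∃[ k ] (length F ≡ m r k)
      cofinal    : (xs : List Carrier) →
                   ∃[ F ] (𝓕 F × All (λ x → x ∈ F) xs)
      -- (i) E ∩ F is an initial segment of both
      coherent   : (k : ℕ) (E F : List Carrier) → InLevel k E → InLevel k F →
                   ∃[ P ] ∃[ E' ] ∃[ F' ] (E ≡ P ++ E' × F ≡ P ++ F' ×
                     ((x : Carrier) → x ∈ E' → x ∈ F → ⊥) ×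
                     ((x : Carrier) → x ∈ F' → x ∈ E → ⊥))
      decomposes : (k : ℕ) (F : List Carrier) → InLevel (suc k) F →
                   ∃[ R ] ∃[ A ] ∃[ B ] Decomp k F R A B

  -- Values of Ξ_α(k): -1 (root) or i ∈ {0,1}
  data Tag : Set where
    root  : Tag
    piece : Fin 2 → Tag

  -- Ξ_α(k+1) = t  (as a relation; well-definedness is a known fact)
  Xi : Carrier → ℕ → Tag → Set
  Xi α k t = ∃[ F ] ∃[ R ] ∃[ A ] ∃[ B ] (InLevel (suc k) F × α ∈ F ×
               Decomp k F R A B ×
               ((α ∈ R × t ≡ root) ⊎ (α ∈ A × t ≡ piece Fin.zero)
                 ⊎ (α ∈ B × t ≡ piece (Fin.suc Fin.zero))))

  -- L_α = {2k + Ξ_α(k) : k ≥ 1, Ξ_α(k) ≥ 0}, here with k = suc j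
  L : Carrier → ℕ → Set
  L α n = ∃[ j ] ((Xi α j (piece Fin.zero) × n ≡ 2 * suc j)
                ⊎ (Xi α j (piece (Fin.suc Fin.zero)) × n ≡ 2 * suc j + 1))

  Rs : Carrier → ℕ → Set
  Rs α n = ∃[ j ] ((Xi α j (piece Fin.zero) × n ≡ 2 * suc j + 1)
                ⊎ (Xi α j (piece (Fin.suc Fin.zero)) × n ≡ 2 * suc j))

FiniteSet : (ℕ → Set) → Set
FiniteSet P = ∃[ N ] ((n : ℕ) → P n → n < N)

{-# OPTIONS --safe #-}
-- Take C to be the positive even numbers.  Then the numbers to be bounded are 2k+1 ∈ L_{α+1} ∖ L_α
-- and 2k ∈ R_{α+1} ∖ R_α, which come from levels k with Ξ_{α+1}(k) = 1 but Ξ_α(k) ≠ 1, so it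
-- suffices that such k are bounded.  Fix G ∈ 𝓕_K containing α and α+1.  Any F of level ≥ K
-- containing α+1 contains some H ∈ 𝓕_K with α+1 ∈ H, and H ∩ G is an initial segment of G, so
-- α ∈ F.  Hence if α+1 lies in the right half R(F) ∪ F₁ of F ∈ 𝓕_{k+1}, k ≥ K, so does α; and
-- α ∉ R(F), since the nonempty F₀ ∖ R(F) lies strictly between R(F) and α+1.

module Submission where

open import Defs
open import Data.Nat using (ℕ; suc; _+_; _*_; _<_; _≤_; _≤′_; ≤′-refl; ≤′-step; s<s; _<?_)
open import Data.Nat.Properties
  using (≤⇒≤′; ≮⇒≥; ≤-<-trans; m≤m+n; +-monoˡ-<; *-monoʳ-<; +-comm; even≢odd; <-irrefl)
open import Data.List using (List; []; _∷_; _++_; length)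
open import Data.List.Properties using (++-assoc; ++-identityʳ)
open import Data.List.Membership.Propositional using (_∈_)
open import Data.List.Membership.Propositional.Properties using (∈-++⁺ˡ; ∈-++⁺ʳ; ∈-++⁻)
open import Data.List.Relation.Binary.Subset.Propositional using (_⊆_)
open import Data.List.Relation.Binary.Subset.Propositional.Properties
  using (xs⊆xs++ys; xs⊆ys++xs; ++⁺ʳ; ⊆-trans)
open import Data.List.Relation.Unary.Any using (here; there)
open import Data.List.Relation.Unary.All as All using ()
open import Data.List.Relation.Unary.AllPairs using (AllPairs; _∷_)
open import Data.List.Relation.Unary.Linked.Properties using (Linked⇒AllPairs)
open import Data.Fin as Fin using ()
open import Data.Product using (Σ; ∃-syntax; _×_; _,_; proj₁; proj₂)
open import Data.Sum using (inj₁; inj₂)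
open import Data.Empty using (⊥; ⊥-elim)
open import Relation.Nullary using (¬_; yes; no)
open import Relation.Binary.PropositionalEquality
  using (_≡_; _≢_; refl; sym; trans; cong; subst; module ≡-Reasoning)
open import Relation.Binary.Structures using (IsStrictTotalOrder)

AllPairs-++⁻-cross : ∀ {A : Set} {_∼_ : A → A → Set} xs {ys : List A} {x y : A} →
  AllPairs _∼_ (xs ++ ys) → x ∈ xs → y ∈ ys → x ∼ y
AllPairs-++⁻-cross (_ ∷ xs) (px ∷ _)   (here refl)  y∈ys = All.lookup px (∈-++⁺ʳ xs y∈ys)
AllPairs-++⁻-cross (_ ∷ xs) (_ ∷ pxs) (there x∈xs) y∈ys = AllPairs-++⁻-cross xs pxs x∈xs y∈ys

2*suc≢2*suc+1 : ∀ i j → 2 * suc i ≢ 2 * suc j + 1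
2*suc≢2*suc+1 i j eq = even≢odd (suc i) (suc j) (trans eq (+-comm (2 * suc j) 1))

2*suc-mono-< : ∀ {j K} → j < K → 2 * suc j + 1 < 2 * suc K + 1
2*suc-mono-< j<K = +-monoˡ-< 1 (*-monoʳ-< 2 (s<s j<K))

PositiveEven : ℕ → Set
PositiveEven n = ∃[ j ] (n ≡ 2 * suc j)

module ConstructionSchemeProperties
  (W : Omega1) (r : ℕ → ℕ) (𝓕 : List (Omega1.Carrier W) → Set)
  (cs : Scheme.IsConstructionScheme W r 𝓕) (valid : ∀ k → r (suc k) < m r k) where

  open Omega1 W
  open Scheme W r 𝓕
  open Scheme.IsConstructionScheme cs
  open IsStrictTotalOrder isSTO using (irrefl; asym) renaming (trans to <ω-trans)

  Right : Tag
  Right = piece (Fin.suc Fin.zero)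

  ordered-++ : ∀ xs {ys x y} → 𝓕 (xs ++ ys) → x ∈ xs → y ∈ ys → x <ω y
  ordered-++ xs {ys} F∈𝓕 =
    AllPairs-++⁻-cross xs (Linked⇒AllPairs <ω-trans (increasing (xs ++ ys) F∈𝓕))

  IsSucc⇒nothing-between : ∀ {α β γ} → IsSucc α β → α <ω γ → γ <ω β → ⊥
  IsSucc⇒nothing-between (_ , least) α<γ γ<β with least _ α<γ
  ... | inj₁ β<γ  = asym β<γ γ<β
  ... | inj₂ refl = irrefl refl γ<β

  left-piece-nonempty : ∀ {k F R A B} → Decomp k F R A B → ∃[ γ ] (γ ∈ A)
  left-piece-nonempty {A = γ ∷ _} _ = γ , here refl
  left-piece-nonempty {k} {R = R} {A = []} (_ , |R| , (_ , |R++[]|) , _) =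
    ⊥-elim (<-irrefl r≡m (valid k))
    where
      open ≡-Reasoning
      r≡m : r (suc k) ≡ m r k
      r≡m = begin
        r (suc k)          ≡⟨ sym |R| ⟩
        length R           ≡⟨ cong length (sym (++-identityʳ R)) ⟩
        length (R ++ [])   ≡⟨ |R++[]| ⟩
        m r k              ∎

  half-containing : ∀ {k F x} → InLevel (suc k) F → x ∈ F →
    ∃[ H ] (InLevel k H × x ∈ H × H ⊆ F)
  half-containing {k} F∈𝓕 x∈F with decomposes k _ F∈𝓕
  ... | R , A , B , refl , _ , RA∈𝓕 , RB∈𝓕 with ∈-++⁻ R x∈F
  ... | inj₁ x∈R = R ++ A , RA∈𝓕 , ∈-++⁺ˡ x∈R , ++⁺ʳ R (xs⊆xs++ys A B)
  ... | inj₂ x∈AB with ∈-++⁻ A x∈AB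
  ...   | inj₁ x∈A = R ++ A , RA∈𝓕 , ∈-++⁺ʳ R x∈A , ++⁺ʳ R (xs⊆xs++ys A B)
  ...   | inj₂ x∈B = R ++ B , RB∈𝓕 , ∈-++⁺ʳ R x∈B , ++⁺ʳ R (xs⊆ys++xs B A)

  descend : ∀ {K k H x} → K ≤′ k → InLevel k H → x ∈ H →
    ∃[ H' ] (InLevel K H' × x ∈ H' × H' ⊆ H)
  descend ≤′-refl H∈𝓕 x∈H = _ , H∈𝓕 , x∈H , λ p → p
  descend (≤′-step K≤′k) H∈𝓕 x∈H with half-containing H∈𝓕 x∈H
  ... | H₁ , H₁∈𝓕 , x∈H₁ , H₁⊆H with descend K≤′k H₁∈𝓕 x∈H₁
  ... | H' , H'∈𝓕 , x∈H' , H'⊆H₁ = H' , H'∈𝓕 , x∈H' , ⊆-trans H'⊆H₁ H₁⊆H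

  coherent-downward-closed : ∀ {K G H α β} → InLevel K G → InLevel K H →
    α ∈ G → β ∈ G → β ∈ H → α <ω β → α ∈ H
  coherent-downward-closed {K} {G} {H} G∈𝓕 H∈𝓕 α∈G β∈G β∈H α<β with coherent K G H G∈𝓕 H∈𝓕
  ... | P , G' , H' , refl , refl , _ , H'∩G=∅ with ∈-++⁻ P β∈H
  ... | inj₂ β∈H' = ⊥-elim (H'∩G=∅ _ β∈H' β∈G)
  ... | inj₁ β∈P with ∈-++⁻ P α∈G
  ...   | inj₁ α∈P  = ∈-++⁺ˡ α∈P
  ...   | inj₂ α∈G' = ⊥-elim (asym α<β (ordered-++ P (proj₁ G∈𝓕) β∈P α∈G'))

  above-level-downward-closed : ∀ {K k G H α β} → InLevel K G → α ∈ G → β ∈ G → α <ω β →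
    K ≤ k → InLevel k H → β ∈ H → α ∈ H
  above-level-downward-closed {K} G∈𝓕 α∈G β∈G α<β K≤k H∈𝓕 β∈H
    with descend {K} (≤⇒≤′ K≤k) H∈𝓕 β∈H
  ... | H' , H'∈𝓕 , β∈H' , H'⊆H = H'⊆H (coherent-downward-closed {K} G∈𝓕 H'∈𝓕 α∈G β∈G β∈H' α<β)

  IsSucc⇒∉root : ∀ {α β k F R A B} → IsSucc α β → InLevel (suc k) F → Decomp k F R A B →
    β ∈ B → α ∈ R → ⊥
  IsSucc⇒∉root {R = R} {A} {B} α+1≡β (F∈𝓕 , _) dec@(refl , _ , (RA∈𝓕 , _) , _) β∈B α∈R
    with left-piece-nonempty dec
  ... | γ , γ∈A = IsSucc⇒nothing-between α+1≡β
                    (ordered-++ R RA∈𝓕 α∈R γ∈A) (ordered-++ (R ++ A) RA,B∈𝓕 (∈-++⁺ʳ R γ∈A) β∈B)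
    where
      RA,B∈𝓕 : 𝓕 ((R ++ A) ++ B)
      RA,B∈𝓕 = subst 𝓕 (sym (++-assoc R A B)) F∈𝓕

  succ-eventually-inherits-Right : ∀ {α β} → IsSucc α β →
    ∃[ K ] (∀ j → K ≤ j → Xi β j Right → Xi α j Right)
  succ-eventually-inherits-Right {α} {β} α+1≡β with cofinal (α ∷ β ∷ [])
  ... | G , G∈𝓕 , (α∈G All.∷ β∈G All.∷ All.[]) with sizes G G∈𝓕
  ... | K , |G| = K , inherit
    where
      inherit : ∀ j → K ≤ j → Xi β j Right → Xi α j Right
      inherit _ _ (_ , _ , _ , _ , _ , _ , _ , inj₁ (_ , ()))
      inherit _ _ (_ , _ , _ , _ , _ , _ , _ , inj₂ (inj₁ (_ , ())))
      inherit _ K≤j (_ , R , A , B , F∈𝓕 , _ , dec@(refl , _ , _ , RB∈𝓕) , inj₂ (inj₂ (β∈B , _)))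
        with ∈-++⁻ R (above-level-downward-closed (G∈𝓕 , |G|) α∈G β∈G
                        (proj₁ α+1≡β) K≤j RB∈𝓕 (∈-++⁺ʳ R β∈B))
      ... | inj₁ α∈R = ⊥-elim (IsSucc⇒∉root α+1≡β F∈𝓕 dec β∈B α∈R)
      ... | inj₂ α∈B = _ , R , A , B , F∈𝓕 , ∈-++⁺ʳ R (∈-++⁺ʳ A α∈B) , dec , inj₂ (inj₂ (α∈B , refl))

  module _ {α β K} (inherit : ∀ j → K ≤ j → Xi β j Right → Xi α j Right) where

    new-L-outside-evens-bounded : FiniteSet (λ n → L β n × ¬ L α n × ¬ PositiveEven n)
    new-L-outside-evens-bounded = 2 * suc K + 1 , bounded
      where
        bounded : ∀ n → L β n × ¬ L α n × ¬ PositiveEven n → n < 2 * suc K + 1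
        bounded n ((j , inj₁ (_ , n≡2j)) , _ , n∉C) = ⊥-elim (n∉C (j , n≡2j))
        bounded n ((j , inj₂ (ξ , refl)) , n∉Lα , _) with j <? K
        ... | yes j<K = 2*suc-mono-< j<K
        ... | no j≮K  = ⊥-elim (n∉Lα (j , inj₂ (inherit j (≮⇒≥ j≮K) ξ , refl)))

    new-Rs-inside-evens-bounded : FiniteSet (λ n → PositiveEven n × Rs β n × ¬ Rs α n)
    new-Rs-inside-evens-bounded = 2 * suc K + 1 , bounded
      where
        bounded : ∀ n → PositiveEven n × Rs β n × ¬ Rs α n → n < 2 * suc K + 1
        bounded n ((i , n≡2i) , (j , inj₁ (_ , n≡2j+1)) , _) =
          ⊥-elim (2*suc≢2*suc+1 i j (trans (sym n≡2i) n≡2j+1))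
        bounded n (_ , (j , inj₂ (ξ , refl)) , n∉Rα) with j <? K
        ... | yes j<K = ≤-<-trans (m≤m+n _ 1) (2*suc-mono-< j<K)
        ... | no j≮K  = ⊥-elim (n∉Rα (j , inj₂ (inherit j (≮⇒≥ j≮K) ξ , refl)))

mainTheorem5 : (W : Omega1) (r : ℕ → ℕ) → IsGood2Type r →
    (𝓕 : List (Omega1.Carrier W) → Set) →
    Scheme.IsConstructionScheme W r 𝓕 →
    Σ (ℕ → Set) λ C → (α β : Omega1.Carrier W) → Omega1.IsSucc W α β →
      FiniteSet (λ n → Scheme.L W r 𝓕 β n × ¬ Scheme.L W r 𝓕 α n × ¬ C n) ×
      FiniteSet (λ n → C n × Scheme.Rs W r 𝓕 β n × ¬ Scheme.Rs W r 𝓕 α n)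
mainTheorem5 W r good 𝓕 cs = PositiveEven , λ α β α+1≡β →
  let inherit = proj₂ (succ-eventually-inherits-Right α+1≡β)
  in new-L-outside-evens-bounded inherit , new-Rs-inside-evens-bounded inherit
  where open ConstructionSchemeProperties W r 𝓕 cs (proj₁ good)
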